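{- Let $\mathbb A$ be an $\omega$-categorical structure, let $1\leq k\leq m\leq n$, let $S\subseteq R\subseteq A^k$ be relations pp-definable in $\mathbb A$ with $S\trianglelefteq_{\mathbb A} R$. Let $\mathcal I=(\mathcal V,\mathcal C)$ be a non-trivial $(m,n)$-minimal instance of $\mathrm{CSP}(\mathbb A)$. Let $\mathcal I'$ be obtained from $\mathcal I$ by adding, for every $\mathbf v=(v_1,\ldots,v_k)\in\mathcal V^k$ with $\mathrm{proj}_{\mathbf v}(\mathcal I)\subseteq R$, $S\cap\mathrm{proj}_{\mathbf v}(\mathcal I)\neq\emptyset$ and $S\cap\mathrm{proj}_{\mathbf v}(\mathcal I)\trianglelefteq_{\mathbb A} R$, the constraint $\{c\colon\{v_1,\ldots,v_k\}\to A\mid c(\mathbf v)\in S\}$. Then the $(m,n)$-minimal instance equivalent to $\mathcal I'$ is non-trivial.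
   Context: For $S'\subseteq R\subseteq A^k$, $S'\trianglelefteq_{\mathbb A} R$ means there is a binary polymorphism $f$ of $\mathbb A$ with $f(\mathbf a,\mathbf b),f(\mathbf b,\mathbf a)\in S'$ (componentwise) for all $\mathbf a\in S'$, $\mathbf b\in R$. An instance (of $\mathrm{CSP}(\mathbb A)$) is a pair $(\mathcal V,\mathcal C)$ with a finite set $\mathcal V$ of variables and finitely many constraints, each a set $C\subseteq A^U$ of maps from its scope $U\subseteq\mathcal V$ to $A$ (for $\mathrm{CSP}(\mathbb A)$, the tuples of $C$ in some enumeration of $U$ form a relation of $\mathbb A$). It is trivial if some constraint is empty. For a tuple $\mathbf v$ of variables, $c(\mathbf v)$ is the tuple of values. An instance is $(m,n)$-minimal if every set of at most $n$ variables lies in the scope of some constraint and, for every set $W$ of at most $m$ variables, all constraints whose scopes contain $W$ have the same set of restrictions to $W$; then for a tuple $\mathbf v$ with at most $m$ distinct entries, $\mathrm{proj}_{\mathbf v}(\mathcal I)=\{c(\mathbf v): c\in C\}$ for any constraint $C$ whose scope contains those entries. The $(m,n)$-minimal instance equivalent to an instance is obtained by adding, for each set $W$ of at most $n$ variables, the constraint of all maps $W\to A$, and then repeatedly removing from a constraint $C$ every map $f$ for which there is a set $W$ of at most $m$ variables in the scope of $C$ and a constraint $D$ whose scope contains $W$ such that $f|_W$ is not a restriction of a map in $D$, until no change occurs. -}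

module Defs where

open import Data.Nat using (ℕ; zero; suc; _≤_)
open import Data.Fin using (Fin)
open import Data.Vec using (Vec; []; _∷_; lookup; map; zipWith)
open import Data.Fin.Subset as Sub using (Subset; ∣_∣; ⁅_⁆; _∪_; _⊆_)
open import Data.Product using (Σ; _×_; _,_)
open import Data.Sum using (_⊎_; inj₁; inj₂)
open import Data.Unit using (⊤)
open import Relation.Nullary using (¬_)
open import Relation.Binary.PropositionalEquality using (_≡_)
open import Function.Bundles using (_↔_; _↣_; Inverse)

_⇔_ : Set → Set → Set
P ⇔ Q = (P → Q) × (Q → P)

-- Relational structures (arbitrary relational signature).
-- Tuples are vectors, so relations are automatically extensional.

record Structure : Set₁ where
  field
    Carrier : Set
    Sym     : Set
    ar      : Sym → ℕ
    rel     : (s : Sym) → Vec Carrier (ar s) → Set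

module _ (𝔸 : Structure) where
  open Structure 𝔸

  IsAutomorphism : (Carrier ↔ Carrier) → Set
  IsAutomorphism σ =
    ∀ s (a : Vec Carrier (ar s)) → rel s a ⇔ rel s (map (Inverse.to σ) a)

  Oligomorphic : Set
  Oligomorphic = ∀ n → Σ ℕ λ M → Σ (Fin M → Vec Carrier n) λ reps →
    ∀ (a : Vec Carrier n) → Σ (Fin M) λ i → Σ (Carrier ↔ Carrier) λ σ →
      IsAutomorphism σ × (map (Inverse.to σ) (reps i) ≡ a)

  -- ω-categorical = countable (possibly finite) with oligomorphic
  -- automorphism group (Ryll-Nardzewski / Engeler / Svenonius).
  ωCategorical : Set
  ωCategorical = (Carrier ↣ ℕ) × Oligomorphic

  data PP (n : ℕ) : Set where
    atom : (s : Sym) → Vec (Fin n) (ar s) → PP n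
    eq   : Fin n → Fin n → PP n
    and  : PP n → PP n → PP n
    ex   : PP (suc n) → PP n

  ⟦_⟧ : ∀ {n} → PP n → Vec Carrier n → Set
  ⟦ atom s xs ⟧ env = rel s (map (lookup env) xs)
  ⟦ eq x y ⟧    env = lookup env x ≡ lookup env y
  ⟦ and φ ψ ⟧   env = ⟦ φ ⟧ env × ⟦ ψ ⟧ env
  ⟦ ex φ ⟧      env = Σ Carrier λ a → ⟦ φ ⟧ (a ∷ env)

  PPDefinable : ∀ {k} → (Vec Carrier k → Set) → Set
  PPDefinable {k} R = Σ (PP k) λ φ → ∀ a → R a ⇔ ⟦ φ ⟧ a

  IsBinaryPolymorphism : (Carrier → Carrier → Carrier) → Set
  IsBinaryPolymorphism f =
    ∀ s (a b : Vec Carrier (ar s)) → rel s a → rel s b → rel s (zipWith f a b)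

  Absorbs : ∀ {k} → (Vec Carrier k → Set) → (Vec Carrier k → Set) → Set
  Absorbs S' R = (∀ a → S' a → R a) ×
    (Σ (Carrier → Carrier → Carrier) λ f → IsBinaryPolymorphism f ×
      (∀ a b → S' a → R b → S' (zipWith f a b) × S' (zipWith f b a)))

-- A constraint has a scope U ⊆ Fin N
-- and a set of maps U → A, represented by the predicate on total
-- assignments (Vec A N) determined by their restrictions to U.

record Constraint (A : Set) (N : ℕ) : Set₁ where
  field
    scope : Subset N
    mem   : Vec A N → Set

record Instance (A : Set) (N : ℕ) : Set₁ where
  field
    Idx : Set
    con : Idx → Constraint A N

open Constraint
open Instance

finInstance : ∀ {A N M} → (Fin M → Constraint A N) → Instance A N
finInstance {M = M} cs = record { Idx = Fin M ; con = cs }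

Agree : ∀ {A N} → Vec A N → Vec A N → Subset N → Set
Agree f g W = ∀ i → i Sub.∈ W → lookup f i ≡ lookup g i

vars : ∀ {N k} → Vec (Fin N) k → Subset N
vars []       = Sub.⊥
vars (x ∷ xs) = ⁅ x ⁆ ∪ vars xs

Trivial : ∀ {A N} → Instance A N → Set
Trivial {A} {N} I = Σ (Idx I) λ j → ¬ (Σ (Vec A N) λ f → mem (con I j) f)

NonTrivial : ∀ {A N} → Instance A N → Set
NonTrivial I = ¬ Trivial I

-- I is an instance of CSP(𝔸): each constraint, read in some enumeration
-- (injective tuple u) of its scope, is a relation of 𝔸.
IsCSPInstance : (𝔸 : Structure) → ∀ {N} → Instance (Structure.Carrier 𝔸) N → Set
IsCSPInstance 𝔸 {N} I = ∀ j →
  Σ (Structure.Sym 𝔸) λ s → Σ (Vec (Fin N) (Structure.ar 𝔸 s)) λ u →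
    (∀ p q → lookup u p ≡ lookup u q → p ≡ q) ×
    (∀ i → (i Sub.∈ scope (con I j)) ⇔ (Σ _ λ p → lookup u p ≡ i)) ×
    (∀ f → mem (con I j) f ⇔ Structure.rel 𝔸 s (map (lookup f) u))

IsMinimal : ∀ {A N} → ℕ → ℕ → Instance A N → Set
IsMinimal {A} {N} m n I =
  (∀ (W : Subset N) → ∣ W ∣ ≤ n → Σ (Idx I) λ j → W ⊆ scope (con I j)) ×
  (∀ (W : Subset N) → ∣ W ∣ ≤ m → ∀ j j' → W ⊆ scope (con I j) → W ⊆ scope (con I j') →
     ∀ f → mem (con I j) f → Σ (Vec A N) λ g → mem (con I j') g × Agree f g W)

Proj : ∀ {A N k} → Instance A N → Vec (Fin N) k → Vec A k → Set
Proj {A} {N} I v a = Σ (Idx I) λ j → vars v ⊆ scope (con I j) ×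
  (Σ (Vec A N) λ f → mem (con I j) f × (map (lookup f) v ≡ a))

AddCond : (𝔸 : Structure) → ∀ {N k} → Instance (Structure.Carrier 𝔸) N →
  (S R : Vec (Structure.Carrier 𝔸) k → Set) → Vec (Fin N) k → Set
AddCond 𝔸 I S R v =
  (∀ a → Proj I v a → R a) ×
  (Σ _ λ a → S a × Proj I v a) ×
  Absorbs 𝔸 (λ a → S a × Proj I v a) R

extend : (𝔸 : Structure) → ∀ {N} (k : ℕ) → Instance (Structure.Carrier 𝔸) N →
  (S R : Vec (Structure.Carrier 𝔸) k → Set) → Instance (Structure.Carrier 𝔸) N
extend 𝔸 {N} k I S R = record { Idx = Idx I ⊎ Σ (Vec (Fin N) k) (AddCond 𝔸 I S R) ; con = c }
  where
  c : Idx I ⊎ Σ (Vec (Fin N) k) (AddCond 𝔸 I S R) → Constraint _ N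
  c (inj₁ j)       = con I j
  c (inj₂ (v , _)) = record { scope = vars v ; mem = λ f → S (map (lookup f) v) }

-- Step 1 of the (m,n)-minimal equivalent: add all-maps constraints on
-- every set of at most n variables.
addFull : ∀ {A N} → ℕ → Instance A N → Instance A N
addFull {A} {N} n I = record { Idx = Idx I ⊎ Σ (Subset N) (λ W → ∣ W ∣ ≤ n) ; con = c }
  where
  c : Idx I ⊎ Σ (Subset N) (λ W → ∣ W ∣ ≤ n) → Constraint A N
  c (inj₁ j)       = con I j
  c (inj₂ (W , _)) = record { scope = W ; mem = λ _ → ⊤ }

-- Step 2: the removal process; stage i = after i rounds of removal.
stage : ∀ {A N} → ℕ → (I : Instance A N) → ℕ → Idx I → Vec A N → Set
stage m I zero    j f = mem (con I j) f
stage {A} {N} m I (suc t) j f = stage m I t j f ×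
  (∀ (W : Subset N) → ∣ W ∣ ≤ m → W ⊆ scope (con I j) → ∀ d → W ⊆ scope (con I d) →
     Σ (Vec A N) λ g → stage m I t d g × Agree f g W)

-- The (m,n)-minimal instance equivalent to I: maps surviving all rounds
-- (the process stabilises, so this is its final result).
minimalEquiv : ∀ {A N} → ℕ → ℕ → Instance A N → Instance A N
minimalEquiv {A} {N} m n I = record
  { Idx = Idx J
  ; con = λ j → record { scope = scope (con J j) ; mem = λ f → ∀ t → stage m J t j f } }
  where J = addFull n I

-- Call a map admissible for a constraint of I' if it is locally consistent with I
-- on the scope (and, for a constraint of I, belongs to it).  Admissible maps are
-- closed under the absorbing polymorphism h of S ⊴ R, and every constraint absorbs
-- them: for an added constraint on v, an admissible c has c(v) ∈ proj_v(I) ⊆ R.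
-- Absorption propagates through every round of the removal process, so combining
-- finitely many witnesses with h shows that after any number of rounds each
-- constraint still contains an admissible map.  Since the automorphisms of 𝔸 have
-- finitely many orbits on maps and I' has finitely many kinds of constraints, the
-- rounds stabilise after finitely many steps, and a map surviving that round
-- survives forever.  The argument is
-- classical; it runs in the double-negation monad, which suffices because
-- non-triviality is a negation.

module Submission where

open import Defs
open import Data.Bool using (Bool; true; false)
open import Data.Empty using (⊥-elim)
open import Data.Fin using (Fin)
open import Data.Fin.Subset using (Subset; ∣_∣; ⁅_⁆; _∪_; _⊆_)
open import Data.Fin.Subset.Properties using (x∈⁅x⁆; p⊆p∪q; q⊆p∪q; ∣⊥∣≡0; ∣⁅x⁆∣≡1)
open import Data.List as List using (List; []; _∷_; [_]; _++_; allFin; cartesianProduct)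
open import Data.List.Membership.Propositional using (_∈_)
open import Data.List.Membership.Propositional.Properties
  using (∈-map⁺; ∈-++⁺ˡ; ∈-++⁺ʳ; ∈-allFin; ∈-cartesianProduct⁺)
open import Data.List.Relation.Unary.Any using (here; there)
open import Data.Nat using (ℕ; zero; suc; _+_; _∸_; _≤_; z≤n; s≤s)
open import Data.Nat.Properties using (≤-trans; ≤-reflexive; +-comm; +-suc; +-monoʳ-≤; n≤1+n; m∸n+n≡m; <⇒≤)
open import Data.Product using (Σ; _×_; _,_; proj₁; proj₂; uncurry)
open import Data.Sum using (_⊎_; inj₁; inj₂)
open import Data.Unit using (⊤; tt)
open import Data.Vec using (Vec; []; _∷_; lookup; map; zipWith)
open import Data.Vec.Properties using (lookup-map; lookup-zipWith; map-cong; map-∘; map-id)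
open import Effect.Monad using (RawMonad)
open import Function.Bundles using (Inverse)
open import Function.Properties.Inverse using (↔-sym)
open import Relation.Nullary using (¬_; yes; no)
open import Relation.Nullary.Decidable using (¬¬-excluded-middle)
open import Relation.Nullary.Negation using (¬¬-Monad)
open import Relation.Binary.PropositionalEquality
  using (_≡_; refl; sym; trans; cong; cong₂; subst)
open import Level using (0ℓ)

open RawMonad (¬¬-Monad {0ℓ}) using (pure; _>>=_)

record Finite (X : Set) : Set where
  field
    elements : List X
    complete : ∀ x → x ∈ elements

open Finite

Fin-finite : ∀ n → Finite (Fin n)
Fin-finite n = record { elements = allFin n ; complete = ∈-allFin }

Bool-finite : Finite Bool
Bool-finite = record { elements = true ∷ false ∷ [] ; complete = λ where
  true  → here refl
  false → there (here refl) }

⊎-finite : ∀ {X Y} → Finite X → Finite Y → Finite (X ⊎ Y)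
⊎-finite X Y = record
  { elements = List.map inj₁ (elements X) ++ List.map inj₂ (elements Y)
  ; complete = λ where
      (inj₁ x) → ∈-++⁺ˡ (∈-map⁺ inj₁ (complete X x))
      (inj₂ y) → ∈-++⁺ʳ _ (∈-map⁺ inj₂ (complete Y y)) }

×-finite : ∀ {X Y} → Finite X → Finite Y → Finite (X × Y)
×-finite X Y = record
  { elements = cartesianProduct (elements X) (elements Y)
  ; complete = λ (x , y) → ∈-cartesianProduct⁺ (complete X x) (complete Y y) }

Vec-finite : ∀ {X} → Finite X → ∀ n → Finite (Vec X n)
Vec-finite X zero    = record { elements = [ [] ] ; complete = λ where [] → here refl }
Vec-finite X (suc n) = record
  { elements = List.map (uncurry _∷_) (elements X×Xⁿ)
  ; complete = λ where (x ∷ v) → ∈-map⁺ (uncurry _∷_) (complete X×Xⁿ (x , v)) }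
  where X×Xⁿ = ×-finite X (Vec-finite X n)

Subset-finite : ∀ n → Finite (Subset n)
Subset-finite = Vec-finite Bool-finite

module _ {X : Set} (Q : ℕ → X → Set) where

  StableOn : List X → ℕ → Set
  StableOn xs t = ∀ x → x ∈ xs → Q t x → Q (suc t) x

  module _ (decreasing : ∀ t x → Q (suc t) x → Q t x) where

    decreasing-+ : ∀ u {t x} → Q (u + t) x → Q t x
    decreasing-+ zero    q = q
    decreasing-+ (suc u) q = decreasing-+ u (decreasing _ _ q)

    decreasing-≤ : ∀ {t t' x} → t ≤ t' → Q t' x → Q t x
    decreasing-≤ {t} {t'} {x} t≤t' q =
      decreasing-+ (t' ∸ t) (subst (λ t'' → Q t'' x) (sym (m∸n+n≡m t≤t')) q)

    -- Once Q (suc t) x fails it fails forever, so each x destabilises Q at most once.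
    eventually-stable : ∀ xs t₀ → ¬ ¬ Σ ℕ λ t → t₀ ≤ t × StableOn xs t
    eventually-stable []       t₀ = pure (t₀ , ≤-reflexive refl , λ _ ())
    eventually-stable (x ∷ xs) t₀ = do
      (t , t₀≤t , stable) ← eventually-stable xs t₀
      yes Qx ← ¬¬-excluded-middle {A = Q (suc t) x}
        where no ¬Qx → do
          (t' , t<t' , stable') ← eventually-stable xs (suc t)
          pure (t' , ≤-trans t₀≤t (<⇒≤ t<t') , λ where
            _ (here refl) Qx → ⊥-elim (¬Qx (decreasing-≤ t<t' Qx))
            y (there y∈xs) → stable' y y∈xs)
      pure (t , t₀≤t , λ where
        _ (here refl) _ → Qx
        y (there y∈xs) → stable y y∈xs)

∣p∪q∣≤∣p∣+∣q∣ : ∀ {n} (p q : Subset n) → ∣ p ∪ q ∣ ≤ ∣ p ∣ + ∣ q ∣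
∣p∪q∣≤∣p∣+∣q∣ []          []          = z≤n
∣p∪q∣≤∣p∣+∣q∣ (true ∷ p)  (true ∷ q)  = s≤s (≤-trans (∣p∪q∣≤∣p∣+∣q∣ p q) (+-monoʳ-≤ ∣ p ∣ (n≤1+n ∣ q ∣)))
∣p∪q∣≤∣p∣+∣q∣ (true ∷ p)  (false ∷ q) = s≤s (∣p∪q∣≤∣p∣+∣q∣ p q)
∣p∪q∣≤∣p∣+∣q∣ (false ∷ p) (true ∷ q)  =
  ≤-trans (s≤s (∣p∪q∣≤∣p∣+∣q∣ p q)) (≤-reflexive (sym (+-suc ∣ p ∣ ∣ q ∣)))
∣p∪q∣≤∣p∣+∣q∣ (false ∷ p) (false ∷ q) = ∣p∪q∣≤∣p∣+∣q∣ p q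

∣vars∣≤length : ∀ {N k} (v : Vec (Fin N) k) → ∣ vars v ∣ ≤ k
∣vars∣≤length {N} []      = ≤-reflexive (∣⊥∣≡0 N)
∣vars∣≤length     (x ∷ v) = ≤-trans (∣p∪q∣≤∣p∣+∣q∣ ⁅ x ⁆ (vars v))
  (subst (λ c → c + ∣ vars v ∣ ≤ suc _) (sym (∣⁅x⁆∣≡1 x)) (s≤s (∣vars∣≤length v)))

module _ {A : Set} where

  map-lookup-map : ∀ {N k} (τ : A → A) (f : Vec A N) (v : Vec (Fin N) k) →
    map (lookup (map τ f)) v ≡ map τ (map (lookup f) v)
  map-lookup-map τ f v = trans (map-cong (λ i → lookup-map i τ f) v) (map-∘ τ (lookup f) v)

  map-lookup-zipWith : ∀ {N k} (h : A → A → A) (f g : Vec A N) (v : Vec (Fin N) k) →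
    map (lookup (zipWith h f g)) v ≡ zipWith h (map (lookup f) v) (map (lookup g) v)
  map-lookup-zipWith h f g []      = refl
  map-lookup-zipWith h f g (i ∷ v) = cong₂ _∷_ (lookup-zipWith h i f g) (map-lookup-zipWith h f g v)

  map-lookup-agree : ∀ {N k} (f g : Vec A N) (v : Vec (Fin N) k) →
    Agree f g (vars v) → map (lookup f) v ≡ map (lookup g) v
  map-lookup-agree f g []      f≈g = refl
  map-lookup-agree f g (i ∷ v) f≈g = cong₂ _∷_ (f≈g i (p⊆p∪q (vars v) (x∈⁅x⁆ i)))
    (map-lookup-agree f g v (λ j j∈ → f≈g j (q⊆p∪q ⁅ i ⁆ (vars v) j∈)))

  map-inverse : ∀ {n} {τ τ⁻¹ : A → A} → (∀ x → τ⁻¹ (τ x) ≡ x) → (v : Vec A n) →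
    map τ⁻¹ (map τ v) ≡ v
  map-inverse {τ = τ} {τ⁻¹} inverse v =
    trans (sym (map-∘ τ⁻¹ τ v)) (trans (map-cong inverse v) (map-id v))

  Agree-sym : ∀ {N} {f g : Vec A N} {W} → Agree f g W → Agree g f W
  Agree-sym f≈g i i∈ = sym (f≈g i i∈)

  Agree-map : ∀ {N} (τ : A → A) {f g : Vec A N} {W} → Agree f g W → Agree (map τ f) (map τ g) W
  Agree-map τ {f} {g} f≈g i i∈ =
    trans (lookup-map i τ f) (trans (cong τ (f≈g i i∈)) (sym (lookup-map i τ g)))

  Agree-zipWith : ∀ {N} (h : A → A → A) {f g f' g' : Vec A N} {W} →
    Agree f g W → Agree f' g' W → Agree (zipWith h f f') (zipWith h g g') W
  Agree-zipWith h {f} {g} {f'} {g'} f≈g f'≈g' i i∈ =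
    trans (lookup-zipWith h i f f')
      (trans (cong₂ h (f≈g i i∈) (f'≈g' i i∈)) (sym (lookup-zipWith h i g g')))

module _ (𝔸 : Structure) where
  open Structure 𝔸

  IsEndomorphism : (Carrier → Carrier) → Set
  IsEndomorphism τ = ∀ s a → rel s a → rel s (map τ a)

  automorphism⇒endomorphism : ∀ σ → IsAutomorphism 𝔸 σ → IsEndomorphism (Inverse.to σ)
  automorphism⇒endomorphism σ σ-aut s a = proj₁ (σ-aut s a)

  automorphism-inverse : ∀ σ → IsAutomorphism 𝔸 σ → IsAutomorphism 𝔸 (↔-sym σ)
  automorphism-inverse σ σ-aut s a =
      (λ r → proj₂ (σ-aut s (map from a)) (subst (rel s) (sym (map-inverse strictlyInverseˡ a)) r))
    , (λ r → subst (rel s) (map-inverse strictlyInverseˡ a) (proj₁ (σ-aut s (map from a)) r))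
    where open Inverse σ

  ⟦⟧-preserved : ∀ {τ} → IsEndomorphism τ → ∀ {k} (φ : PP 𝔸 k) env → ⟦ 𝔸 ⟧ φ env → ⟦ 𝔸 ⟧ φ (map τ env)
  ⟦⟧-preserved τ-endo (atom s xs) env r = subst (rel s) (sym (map-lookup-map _ env xs)) (τ-endo s _ r)
  ⟦⟧-preserved {τ} τ-endo (eq x y)  env e =
    trans (lookup-map x τ env) (trans (cong τ e) (sym (lookup-map y τ env)))
  ⟦⟧-preserved τ-endo (and φ ψ) env (r , r') = ⟦⟧-preserved τ-endo φ env r , ⟦⟧-preserved τ-endo ψ env r'
  ⟦⟧-preserved {τ} τ-endo (ex φ) env (a , r) = τ a , ⟦⟧-preserved τ-endo φ (a ∷ env) r

  ppDefinable-preserved : ∀ {k} {S : Vec Carrier k → Set} → PPDefinable 𝔸 S →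
    ∀ {τ} → IsEndomorphism τ → ∀ a → S a → S (map τ a)
  ppDefinable-preserved (φ , S⇔φ) τ-endo a Sa =
    proj₂ (S⇔φ _) (⟦⟧-preserved τ-endo φ a (proj₁ (S⇔φ a) Sa))

  module _ {N} {I : Instance Carrier N} (csp : IsCSPInstance 𝔸 I) where
    open Instance I
    open Constraint

    csp-polymorphism-closed : ∀ {h} → IsBinaryPolymorphism 𝔸 h →
      ∀ j {f g} → mem (con j) f → mem (con j) g → mem (con j) (zipWith h f g)
    csp-polymorphism-closed {h} h-pol j {f} {g} f∈ g∈ =
      let (s , u , _ , _ , mem⇔rel) = csp j
      in proj₂ (mem⇔rel _) (subst (rel s) (sym (map-lookup-zipWith h f g u))
           (h-pol s _ _ (proj₁ (mem⇔rel f) f∈) (proj₁ (mem⇔rel g) g∈)))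

    csp-endomorphism-closed : ∀ {τ} → IsEndomorphism τ → ∀ j {f} → mem (con j) f → mem (con j) (map τ f)
    csp-endomorphism-closed {τ} τ-endo j {f} f∈ =
      let (s , u , _ , _ , mem⇔rel) = csp j
      in proj₂ (mem⇔rel _) (subst (rel s) (sym (map-lookup-map τ f u)) (τ-endo s _ (proj₁ (mem⇔rel f) f∈)))

record FinitelyManyConstraints {A N} (J : Instance A N) : Set₁ where
  field
    Kind       : Set
    kinds      : Finite Kind
    kind       : Instance.Idx J → Kind
    constraint : Kind → Constraint A N
    con≡       : ∀ j → Instance.con J j ≡ constraint (kind j)

  con-kind : ∀ {j j'} → kind j ≡ kind j' → Instance.con J j ≡ Instance.con J j'
  con-kind {j} {j'} same = trans (con≡ j) (trans (cong constraint same) (sym (con≡ j')))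

module Stages {A : Set} {N : ℕ} (m : ℕ) (J : Instance A N) where
  open Instance J
  open Constraint

  Stage : ℕ → Idx → Vec A N → Set
  Stage = stage m J

  ExtendsTo : ℕ → Subset N → Idx → Vec A N → Set
  ExtendsTo t W d f = Σ (Vec A N) λ g → Stage t d g × Agree f g W

  stage-resp-con : ∀ t {d d'} → con d ≡ con d' → ∀ {f} → Stage t d f → Stage t d' f
  stage-resp-con zero    d≡d' f∈ = subst (λ C → mem C _) d≡d' f∈
  stage-resp-con (suc t) d≡d' (f∈ , extends) =
    stage-resp-con t d≡d' f∈ , λ W W≤m W⊆ → extends W W≤m (subst (λ C → W ⊆ scope C) (sym d≡d') W⊆)

  stage-map : ∀ τ → (∀ d {f} → mem (con d) f → mem (con d) (map τ f)) →
    ∀ t d {f} → Stage t d f → Stage t d (map τ f)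
  stage-map τ closed zero    d f∈ = closed d f∈
  stage-map τ closed (suc t) d {f} (f∈ , extends) = stage-map τ closed t d f∈ , λ W W≤m W⊆ d' W⊆' →
    let (g , g∈ , f≈g) = extends W W≤m W⊆ d' W⊆'
    in map τ g , stage-map τ closed t d' g∈ , Agree-map τ {f} {g} f≈g

  stage-decreasing : ∀ u t d {f} → Stage (u + t) d f → Stage t d f
  stage-decreasing zero    t d f∈ = f∈
  stage-decreasing (suc u) t d f∈ = stage-decreasing u t d (proj₁ f∈)

  Stable : ℕ → Set
  Stable t = ∀ d {f} → Stage t d f → Stage (suc t) d f

  stable-suc : ∀ {t} → Stable t → Stable (suc t)
  stable-suc stable d f∈@(_ , extends) = f∈ , λ W W≤m W⊆ d' W⊆' →
    let (g , g∈ , f≈g) = extends W W≤m W⊆ d' W⊆' in g , stable d' g∈ , f≈g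

  stable-+ : ∀ u t → Stable t → Stable (u + t)
  stable-+ zero    t stable = stable
  stable-+ (suc u) t stable = stable-suc {u + t} (stable-+ u t stable)

  stable-increasing : ∀ u {t} → Stable t → ∀ d {f} → Stage t d f → Stage (u + t) d f
  stable-increasing zero    stable d f∈ = f∈
  stable-increasing (suc u) stable d f∈ = stable-+ u _ stable d (stable-increasing u stable d f∈)

  stable-fixpoint : ∀ t₀ → Stable t₀ → ∀ d {f} → Stage t₀ d f → ∀ t → Stage t d f
  stable-fixpoint t₀ stable d {f} f∈ t =
    stage-decreasing t₀ t d (subst (λ t' → Stage t' d f) (+-comm t t₀) (stable-increasing t stable d f∈))

  module Absorption (h : A → A → A) (B : Idx → Vec A N → Set)
    (B-closed : ∀ d {x y} → B d x → B d y → B d (zipWith h x y))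
    (B-consistent : ∀ d d' {x} → B d x → ∀ W → ∣ W ∣ ≤ m → W ⊆ scope (con d) → W ⊆ scope (con d') →
      Σ (Vec A N) λ y → B d' y × Agree x y W)
    (mem-absorbs : ∀ d {s c} → mem (con d) s → B d c →
      mem (con d) (zipWith h s c) × mem (con d) (zipWith h c s))
    where
    _∙_ : Vec A N → Vec A N → Vec A N
    _∙_ = zipWith h

    stage-absorbs : ∀ t d {s c} → Stage t d s → B d c → Stage t d (s ∙ c) × Stage t d (c ∙ s)

    extendsTo-absorbs : ∀ t {W d d' s c} → ∣ W ∣ ≤ m → W ⊆ scope (con d) → W ⊆ scope (con d') →
      ExtendsTo t W d' s → B d c → ExtendsTo t W d' (s ∙ c) × ExtendsTo t W d' (c ∙ s)
    extendsTo-absorbs t {W} {d} {d'} {s} {c} W≤m W⊆ W⊆' (g , g∈ , s≈g) Bc =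
      let (y , By , c≈y) = B-consistent d d' Bc W W≤m W⊆ W⊆'
          (g∙y∈ , y∙g∈) = stage-absorbs t d' g∈ By
      in (g ∙ y , g∙y∈ , Agree-zipWith h {s} {g} {c} {y} s≈g c≈y)
       , (y ∙ g , y∙g∈ , Agree-zipWith h {c} {y} {s} {g} c≈y s≈g)

    stage-absorbs zero    d s∈ Bc = mem-absorbs d s∈ Bc
    stage-absorbs (suc t) d {s} (s∈ , extends) Bc =
        (proj₁ (stage-absorbs t d s∈ Bc) , λ W W≤m W⊆ d' W⊆' →
           proj₁ (extendsTo-absorbs t {s = s} W≤m W⊆ W⊆' (extends W W≤m W⊆ d' W⊆') Bc))
      , (proj₂ (stage-absorbs t d s∈ Bc) , λ W W≤m W⊆ d' W⊆' →
           proj₂ (extendsTo-absorbs t {s = s} W≤m W⊆ W⊆' (extends W W≤m W⊆ d' W⊆') Bc))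

    module _ (finitelyMany : FinitelyManyConstraints J)
             (B-inhabited : ∀ d → ¬ ¬ Σ (Vec A N) λ s → mem (con d) s × B d s) where
      open FinitelyManyConstraints finitelyMany

      Witness : ℕ → Idx → Vec A N → Set
      Witness t d s = Stage t d s × B d s

      -- The requirement for reaching stage (suc t), restricted to a set W and a kind κ.
      Meets : ℕ → Idx → Subset N × Kind → Vec A N → Set
      Meets t d (W , κ) s = ∀ d' → kind d' ≡ κ → ∣ W ∣ ≤ m →
        W ⊆ scope (con d) → W ⊆ scope (con d') → ExtendsTo t W d' s

      witness-∙ : ∀ t d {s c} → Witness t d s → B d c → Witness t d (s ∙ c)
      witness-∙ t d (s∈ , Bs) Bc = proj₁ (stage-absorbs t d s∈ Bc) , B-closed d Bs Bc

      meets-∙ˡ : ∀ t d x {s c} → Meets t d x s → B d c → Meets t d x (s ∙ c)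
      meets-∙ˡ t d x {s} meets Bc d' same W≤m W⊆ W⊆' =
        proj₁ (extendsTo-absorbs t {s = s} W≤m W⊆ W⊆' (meets d' same W≤m W⊆ W⊆') Bc)

      meets-∙ʳ : ∀ t d x {s c} → B d s → Meets t d x c → Meets t d x (s ∙ c)
      meets-∙ʳ t d x {c = c} Bs meets d' same W≤m W⊆ W⊆' =
        proj₂ (extendsTo-absorbs t {s = c} W≤m W⊆ W⊆' (meets d' same W≤m W⊆ W⊆') Bs)

      module _ (t : ℕ) (inhabited : ∀ d → ¬ ¬ Σ (Vec A N) (Witness t d)) where

        -- Take a witness g₀ for some d₀ of kind κ, and c ∈ B d, y ∈ B d₀ agreeing on W
        -- with g₀ and s₀ respectively.  On W, s₀ ∙ c agrees with y ∙ g₀, which lies in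
        -- stage t of d₀ (hence of every d' of kind κ) by absorption.
        meets-inhabited : ∀ d {s₀} → Witness t d s₀ → ∀ x →
          ¬ ¬ Σ (Vec A N) λ s → Witness t d s × Meets t d x s
        meets-inhabited d {s₀} s₀-wit@(_ , Bs₀) (W , κ) = do
          yes (d₀ , kind≡κ , W≤m , W⊆ , W⊆₀) ← ¬¬-excluded-middle
              {A = Σ Idx λ d₀ → kind d₀ ≡ κ × ∣ W ∣ ≤ m × W ⊆ scope (con d) × W ⊆ scope (con d₀)}
            where no ∄d₀ → pure (s₀ , s₀-wit , λ d' same W≤m W⊆ W⊆' →
                    ⊥-elim (∄d₀ (d' , same , W≤m , (λ {x} → W⊆ {x}) , (λ {x} → W⊆' {x}))))
          (g₀ , g₀∈ , Bg₀) ← inhabited d₀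
          let (c , Bc , g₀≈c) = B-consistent d₀ d Bg₀ W W≤m W⊆₀ W⊆
              (y , By , s₀≈y) = B-consistent d d₀ Bs₀ W W≤m W⊆ W⊆₀
          pure (s₀ ∙ c , witness-∙ t d s₀-wit Bc , λ d' same _ _ _ →
              y ∙ g₀
            , stage-resp-con t (con-kind (trans kind≡κ (sym same))) (proj₂ (stage-absorbs t d₀ g₀∈ By))
            , Agree-zipWith h {s₀} {y} {c} {g₀} s₀≈y (Agree-sym {f = g₀} {g = c} g₀≈c))

        meets-all-inhabited : ∀ d {s₀} → Witness t d s₀ → ∀ xs →
          ¬ ¬ Σ (Vec A N) λ s → Witness t d s × (∀ x → x ∈ xs → Meets t d x s)
        meets-all-inhabited d s₀-wit []       = pure (_ , s₀-wit , λ _ ())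
        meets-all-inhabited d s₀-wit (x ∷ xs) = do
          (s₁ , s₁-wit , s₁-meets) ← meets-inhabited d s₀-wit x
          (s₂ , s₂-wit , s₂-meets) ← meets-all-inhabited d s₀-wit xs
          pure (s₁ ∙ s₂ , witness-∙ t d s₁-wit (proj₂ s₂-wit) , λ where
            _ (here refl) → meets-∙ˡ t d x {s₁} s₁-meets (proj₂ s₂-wit)
            y (there y∈xs) → meets-∙ʳ t d y {c = s₂} (proj₂ s₁-wit) (s₂-meets y y∈xs))

      stage-inhabited : ∀ t d → ¬ ¬ Σ (Vec A N) (Witness t d)
      stage-inhabited zero    d = B-inhabited d
      stage-inhabited (suc t) d = do
        (s₀ , s₀-wit) ← stage-inhabited t d
        (s , (s∈ , Bs) , meets) ← meets-all-inhabited t (stage-inhabited t) d s₀-wit (elements requirements)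
        pure (s , (s∈ , λ W W≤m W⊆ d' W⊆' →
          meets (W , kind d') (complete requirements _) d' refl W≤m
            (λ {x} → W⊆ {x}) (λ {x} → W⊆' {x})) , Bs)
        where requirements = ×-finite (Subset-finite N) kinds

module _ (𝔸 : Structure) {N : ℕ} (m : ℕ) (J : Instance (Structure.Carrier 𝔸) N)
         (finitelyMany : FinitelyManyConstraints J) where
  open Instance J
  open Constraint
  open FinitelyManyConstraints finitelyMany
  open Stages m J

  -- Membership of f in a stage of d depends only on the orbit of f and the kind
  -- of d, of which there are finitely many pairs.
  oligomorphic⇒stages-stabilise : Oligomorphic 𝔸 →
    (∀ σ → IsAutomorphism 𝔸 σ → ∀ d {f} → mem (con d) f → mem (con d) (map (Inverse.to σ) f)) →
    ¬ ¬ Σ ℕ Stable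
  oligomorphic⇒stages-stabilise oligomorphic aut-closed = do
    (t , _ , stable) ← eventually-stable Q decreasing (elements pairs) 0
    pure (t , stable⇒Stable t stable)
    where
    orbits = proj₁ (oligomorphic N)
    rep    = proj₁ (proj₂ (oligomorphic N))
    orbit  = proj₂ (proj₂ (oligomorphic N))

    Q : ℕ → Kind × Fin orbits → Set
    Q t (κ , o) = ∀ d → kind d ≡ κ → Stage t d (rep o)

    decreasing : ∀ t x → Q (suc t) x → Q t x
    decreasing t x q d same = proj₁ (q d same)

    pairs : Finite (Kind × Fin orbits)
    pairs = ×-finite kinds (Fin-finite orbits)

    stable⇒Stable : ∀ t → StableOn Q (elements pairs) t → Stable t
    stable⇒Stable t stable d {f} f∈ =
      let (o , σ , σ-aut , σrep≡f) = orbit f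
          open Inverse σ
          rep∈ : Stage t d (rep o)
          rep∈ = subst (Stage t d)
                   (trans (cong (map from) (sym σrep≡f)) (map-inverse strictlyInverseʳ (rep o)))
                   (stage-map from (aut-closed (↔-sym σ) (automorphism-inverse 𝔸 σ σ-aut)) t d f∈)
          Q-rep : Q t (kind d , o)
          Q-rep d' same = stage-resp-con t (con-kind (sym same)) rep∈
          rep∈' : Stage (suc t) d (rep o)
          rep∈' = stable (kind d , o) (complete pairs _) Q-rep d refl
      in subst (Stage (suc t) d) σrep≡f (stage-map to (aut-closed σ σ-aut) (suc t) d rep∈')

module _ {A : Set} {N : ℕ} (m : ℕ) (I : Instance A N) where
  open Instance I
  open Constraint

  LocallyConsistent : Subset N → Vec A N → Set
  LocallyConsistent U s = ∀ W → ∣ W ∣ ≤ m → W ⊆ U → ∀ i → W ⊆ scope (con i) →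
    Σ (Vec A N) λ c → mem (con i) c × Agree s c W

  locallyConsistent-⊆ : ∀ {U U'} → U' ⊆ U → ∀ s → LocallyConsistent U s → LocallyConsistent U' s
  locallyConsistent-⊆ U'⊆U s consistent W W≤m W⊆U' = consistent W W≤m (λ x∈ → U'⊆U (W⊆U' x∈))

  minimal⇒locallyConsistent : ∀ {n} → IsMinimal m n I → ∀ i {s} → mem (con i) s →
    LocallyConsistent (scope (con i)) s
  minimal⇒locallyConsistent minimal i {s} s∈ W W≤m W⊆ i' W⊆' = proj₂ minimal W W≤m i i' W⊆ W⊆' s s∈

  locallyConsistent-zipWith : ∀ h →
    (∀ i {f g} → mem (con i) f → mem (con i) g → mem (con i) (zipWith h f g)) →
    ∀ {U} s c → LocallyConsistent U s → LocallyConsistent U c → LocallyConsistent U (zipWith h s c)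
  locallyConsistent-zipWith h closed s c s-consistent c-consistent W W≤m W⊆ i W⊆' =
    let (s' , s'∈ , s≈s') = s-consistent W W≤m W⊆ i W⊆'
        (c' , c'∈ , c≈c') = c-consistent W W≤m W⊆ i W⊆'
    in zipWith h s' c' , closed i s'∈ c'∈ , Agree-zipWith h {s} {s'} {c} {c'} s≈s' c≈c'

module Extension (𝔸 : Structure) {k m n : ℕ} (k≤m : k ≤ m) (m≤n : m ≤ n)
  (S R : Vec (Structure.Carrier 𝔸) k → Set) (S-pp : PPDefinable 𝔸 S)
  {h : Structure.Carrier 𝔸 → Structure.Carrier 𝔸 → Structure.Carrier 𝔸}
  (h-pol : IsBinaryPolymorphism 𝔸 h)
  (h-absorbs : ∀ a b → S a → R b → S (zipWith h a b) × S (zipWith h b a))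
  {N M : ℕ} (cs : Fin M → Constraint (Structure.Carrier 𝔸) N)
  (csp : IsCSPInstance 𝔸 (finInstance cs))
  (nontrivial : NonTrivial (finInstance cs))
  (minimal : IsMinimal m n (finInstance cs)) where

  open Structure 𝔸 using (Carrier)
  open Constraint

  I : Instance Carrier N
  I = finInstance cs

  J : Instance Carrier N
  J = addFull n (extend 𝔸 k I S R)

  open Instance J

  Admissible : Idx → Vec Carrier N → Set
  Admissible (inj₁ (inj₁ i))       s = mem (cs i) s
  Admissible (inj₁ (inj₂ (v , _))) s = LocallyConsistent m I (vars v) s
  Admissible (inj₂ (W , _))        s = LocallyConsistent m I W s

  covering : ∀ d → Σ (Fin M) λ i → scope (con d) ⊆ scope (cs i)
  covering (inj₁ (inj₁ i))       = i , λ x∈ → x∈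
  covering (inj₁ (inj₂ (v , _))) = proj₁ minimal (vars v) (≤-trans (∣vars∣≤length v) (≤-trans k≤m m≤n))
  covering (inj₂ (W , W≤n))      = proj₁ minimal W W≤n

  cover : Idx → Fin M
  cover d = proj₁ (covering d)

  cover-⊇ : ∀ d → scope (con d) ⊆ scope (cs (cover d))
  cover-⊇ d = proj₂ (covering d)

  admissible⇒locallyConsistent : ∀ d {s} → Admissible d s → LocallyConsistent m I (scope (con d)) s
  admissible⇒locallyConsistent (inj₁ (inj₁ i)) s∈ = minimal⇒locallyConsistent m I minimal i s∈
  admissible⇒locallyConsistent (inj₁ (inj₂ _)) s-consistent = s-consistent
  admissible⇒locallyConsistent (inj₂ _)        s-consistent = s-consistent

  cover-admissible : ∀ d {s} → mem (cs (cover d)) s → Admissible d s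
  cover-admissible (inj₁ (inj₁ i)) s∈ = s∈
  cover-admissible d@(inj₁ (inj₂ _)) {s} s∈ =
    locallyConsistent-⊆ m I (cover-⊇ d) s (minimal⇒locallyConsistent m I minimal (cover d) s∈)
  cover-admissible d@(inj₂ _) {s} s∈ =
    locallyConsistent-⊆ m I (cover-⊇ d) s (minimal⇒locallyConsistent m I minimal (cover d) s∈)

  polymorphism-closed : ∀ i {f g} → mem (cs i) f → mem (cs i) g → mem (cs i) (zipWith h f g)
  polymorphism-closed = csp-polymorphism-closed 𝔸 csp h-pol

  admissible-closed : ∀ d {x y} → Admissible d x → Admissible d y → Admissible d (zipWith h x y)
  admissible-closed (inj₁ (inj₁ i)) = polymorphism-closed i
  admissible-closed (inj₁ (inj₂ _)) {x} {y} = locallyConsistent-zipWith m I h polymorphism-closed x y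
  admissible-closed (inj₂ _)        {x} {y} = locallyConsistent-zipWith m I h polymorphism-closed x y

  admissible-consistent : ∀ d d' {x} → Admissible d x → ∀ W → ∣ W ∣ ≤ m →
    W ⊆ scope (con d) → W ⊆ scope (con d') → Σ (Vec Carrier N) λ y → Admissible d' y × Agree x y W
  admissible-consistent d d' x-admissible W W≤m W⊆ W⊆' =
    let (y , y∈ , x≈y) = admissible⇒locallyConsistent d x-admissible W W≤m W⊆
                           (cover d') (λ x∈ → cover-⊇ d' (W⊆' x∈))
    in y , cover-admissible d' y∈ , x≈y

  constraint-absorbs : ∀ d {s c} → mem (con d) s → Admissible d c →
    mem (con d) (zipWith h s c) × mem (con d) (zipWith h c s)
  constraint-absorbs (inj₁ (inj₁ i)) s∈ c∈ = polymorphism-closed i s∈ c∈ , polymorphism-closed i c∈ s∈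
  constraint-absorbs d@(inj₁ (inj₂ (v , proj⊆R , _))) {s} {c} s∈ c-consistent =
    let (c' , c'∈ , c≈c') =
          c-consistent (vars v) (≤-trans (∣vars∣≤length v) k≤m) (λ x∈ → x∈) (cover d) (cover-⊇ d)
        c-proj : Proj I v (map (lookup c) v)
        c-proj = cover d , cover-⊇ d , c' , c'∈ , sym (map-lookup-agree c c' v c≈c')
        (sc∈S , cs∈S) = h-absorbs _ _ s∈ (proj⊆R _ c-proj)
    in subst S (sym (map-lookup-zipWith h s c v)) sc∈S , subst S (sym (map-lookup-zipWith h c s v)) cs∈S
  constraint-absorbs (inj₂ _) _ _ = tt , tt

  original-inhabited : ∀ i → ¬ ¬ Σ (Vec Carrier N) (mem (cs i))
  original-inhabited i ∄s = nontrivial (i , ∄s)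

  constraint-inhabited : ∀ d → ¬ ¬ Σ (Vec Carrier N) λ s → mem (con d) s × Admissible d s
  constraint-inhabited (inj₁ (inj₁ i)) = do
    (s , s∈) ← original-inhabited i
    pure (s , s∈ , s∈)
  constraint-inhabited (inj₁ (inj₂ (v , _ , (a , a∈S , (i , v⊆ , c , c∈ , c[v]≡a)) , _))) =
    pure (c , subst S (sym c[v]≡a) a∈S
            , locallyConsistent-⊆ m I v⊆ c (minimal⇒locallyConsistent m I minimal i c∈))
  constraint-inhabited d@(inj₂ _) = do
    (s , s∈) ← original-inhabited (cover d)
    pure (s , tt , cover-admissible d s∈)

  finitelyMany : FinitelyManyConstraints J
  finitelyMany = record
    { Kind       = Fin M ⊎ (Vec (Fin N) k ⊎ Subset N)
    ; kinds      = ⊎-finite (Fin-finite M) (⊎-finite (Vec-finite (Fin-finite N) k) (Subset-finite N))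
    ; kind       = λ where
        (inj₁ (inj₁ i))       → inj₁ i
        (inj₁ (inj₂ (v , _))) → inj₂ (inj₁ v)
        (inj₂ (W , _))        → inj₂ (inj₂ W)
    ; constraint = λ where
        (inj₁ i)        → cs i
        (inj₂ (inj₁ v)) → record { scope = vars v ; mem = λ f → S (map (lookup f) v) }
        (inj₂ (inj₂ W)) → record { scope = W ; mem = λ _ → ⊤ }
    ; con≡       = λ where
        (inj₁ (inj₁ _)) → refl
        (inj₁ (inj₂ _)) → refl
        (inj₂ _)        → refl
    }

  endomorphism-closed : ∀ {τ} → IsEndomorphism 𝔸 τ → ∀ d {f} → mem (con d) f → mem (con d) (map τ f)
  endomorphism-closed τ-endo (inj₁ (inj₁ i)) f∈ = csp-endomorphism-closed 𝔸 csp τ-endo i f∈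
  endomorphism-closed {τ} τ-endo (inj₁ (inj₂ (v , _))) {f} f∈ =
    subst S (sym (map-lookup-map τ f v)) (ppDefinable-preserved 𝔸 S-pp τ-endo _ f∈)
  endomorphism-closed τ-endo (inj₂ _) _ = tt

  automorphism-closed : ∀ σ → IsAutomorphism 𝔸 σ →
    ∀ d {f} → mem (con d) f → mem (con d) (map (Inverse.to σ) f)
  automorphism-closed σ σ-aut = endomorphism-closed (automorphism⇒endomorphism 𝔸 σ σ-aut)

mainTheorem5 : (𝔸 : Structure) → ωCategorical 𝔸 →
    (k m n : ℕ) → 1 ≤ k → k ≤ m → m ≤ n →
    (S R : Vec (Structure.Carrier 𝔸) k → Set) →
    PPDefinable 𝔸 S → PPDefinable 𝔸 R → (∀ a → S a → R a) → Absorbs 𝔸 S R →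
    (N M : ℕ) (cs : Fin M → Constraint (Structure.Carrier 𝔸) N) →
    IsCSPInstance 𝔸 (finInstance cs) →
    NonTrivial (finInstance cs) → IsMinimal m n (finInstance cs) →
    NonTrivial (minimalEquiv m n (extend 𝔸 k (finInstance cs) S R))
mainTheorem5 𝔸 (_ , oligomorphic) k m n _ k≤m m≤n S R S-pp _ _ (_ , h , h-pol , h-absorbs)
             N M cs csp nontrivial minimal (j , unsatisfiable) =
  oligomorphic⇒stages-stabilise 𝔸 m J finitelyMany oligomorphic automorphism-closed λ (t₀ , stable) →
  stage-inhabited finitelyMany constraint-inhabited t₀ j λ (s , s∈ , _) →
  unsatisfiable (s , stable-fixpoint t₀ stable j s∈)
  where
  open Extension 𝔸 k≤m m≤n S R S-pp h-pol h-absorbs cs csp nontrivial minimal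
  open Stages m J
  open Absorption h Admissible admissible-closed admissible-consistent constraint-absorbs
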